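{- Let $d$ and $n$ be positive integers and $1 \leq a \leq d+1$. Then $$\sum_{\pi \in \mathcal{F}_d^{(a)}(n)} \lambda(\pi) \;-\; \sum_{\pi \in \mathcal{H}_d^{(a)}(n)} \lambda(\pi) \;=\; \sum_{m=1}^{n-1} f_d^{(a)}(n-m)\, f_d^{(1)}(m) \;-\; \sum_{m=1}^{n-1} f_d^{(a)}(n-m)\, f_d^{(d+1)}(m),$$ where $\lambda(\pi)$ is the number of parts of $\pi$, $\mathcal{F}_d^{(c)}(n)$ is the set of partitions of perimeter $n$ all of whose parts are congruent to $c$ modulo $d+1$, $f_d^{(c)}(n)=|\mathcal{F}_d^{(c)}(n)|$, and $\mathcal{H}_d^{(a)}(n)$ is the set of partitions of perimeter $n$ whose parts are $d$-distinct and all at least $a$.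
   Context: A partition is a finite nonincreasing sequence of positive integers (its parts); partitions of any size are allowed. For a partition $\pi$ with largest part $\alpha(\pi)$ and number of parts $\lambda(\pi)$, its perimeter is $\alpha(\pi)+\lambda(\pi)-1$. A partition has $d$-distinct parts if any two of its parts differ by at least $d$. For $1\le c\le d+1$, "parts congruent to $c$ modulo $d+1$" with $c=d+1$ means parts divisible by $d+1$. The right-hand side equals $fp^{(a,1)}(n)-fp^{(a,d+1)}(n)$, where $fp^{(a,b)}(n)$ counts ordered pairs $(\pi_1,\pi_2)$ with $\pi_1\in\mathcal{F}_d^{(a)}(n-m)$, $\pi_2\in\mathcal{F}_d^{(b)}(m)$ for some $1\le m\le n-1$. -}

module Defs where

open import Data.Nat using (ℕ; zero; suc; _+_; _*_; _∸_; _≤_; _≤?_; _%_)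
open import Data.Nat.Properties using (_≟_)
open import Data.List using (List; []; _∷_; length; map; concatMap; filter; upTo)
open import Data.Nat.ListAction using (sum)
open import Data.List.Relation.Unary.All using (All; all?)
open import Data.List.Relation.Unary.AllPairs using (AllPairs; allPairs?)
open import Data.Product using (_×_)
open import Relation.Nullary using (Dec)
open import Relation.Nullary.Decidable using (_×-dec_)
open import Relation.Binary.PropositionalEquality using (_≡_)

IsPartition : List ℕ → Set
IsPartition π = All (1 ≤_) π × AllPairs (λ x y → y ≤ x) π

isPartition? : (π : List ℕ) → Dec (IsPartition π)
isPartition? π = all? (1 ≤?_) π ×-dec allPairs? (λ x y → y ≤? x) π

-- largest part α(π) (0 for the empty partition)
α : List ℕ → ℕ
α []      = 0
α (x ∷ _) = x

λₚ : List ℕ → ℕ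
λₚ = length

perimeter : List ℕ → ℕ
perimeter π = α π + λₚ π ∸ 1

CongParts : ℕ → ℕ → List ℕ → Set
CongParts d c π = All (λ x → x % suc d ≡ c % suc d) π

congParts? : ∀ d c π → Dec (CongParts d c π)
congParts? d c π = all? (λ x → x % suc d ≟ c % suc d) π

-- any two parts differ by at least d (list is nonincreasing, earlier parts are larger)
DDistinct : ℕ → List ℕ → Set
DDistinct d π = AllPairs (λ x y → y + d ≤ x) π

dDistinct? : ∀ d π → Dec (DDistinct d π)
dDistinct? d π = allPairs? (λ x y → y + d ≤? x) π

PartsAtLeast : ℕ → List ℕ → Set
PartsAtLeast a π = All (a ≤_) π

partsAtLeast? : ∀ a π → Dec (PartsAtLeast a π)
partsAtLeast? a π = all? (a ≤?_) π

-- Candidate generator: all nonincreasing lists of length ≤ L with parts in [1..k].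
-- Any partition of perimeter n has at most n parts, all ≤ n, so it occurs in gen n n.
range1 : ℕ → List ℕ
range1 k = map suc (upTo k)

gen : ℕ → ℕ → List (List ℕ)
gen zero    k = [] ∷ []
gen (suc L) k = [] ∷ concatMap (λ j → map (j ∷_) (gen L j)) (range1 k)

candidates : ℕ → List (List ℕ)
candidates n = gen n n

𝓕 : ℕ → ℕ → ℕ → List (List ℕ)
𝓕 d c n = filter (λ π → isPartition? π ×-dec (perimeter π ≟ n ×-dec congParts? d c π))
                 (candidates n)

f : ℕ → ℕ → ℕ → ℕ
f d c n = length (𝓕 d c n)

𝓗 : ℕ → ℕ → ℕ → List (List ℕ)
𝓗 d a n = filter (λ π → isPartition? π ×-dec (perimeter π ≟ n ×-dec
                        (dDistinct? d π ×-dec partsAtLeast? a π)))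
                 (candidates n)

sumλ : List (List ℕ) → ℕ
sumλ S = sum (map λₚ S)

Σ1to : ℕ → (ℕ → ℕ) → ℕ
Σ1to N g = sum (map g (range1 N))

-- Read sequences ℕ → ℕ as power series and put N = d + 1. A partition in 𝓕_d^(c) whose
-- largest part is c + kN has its r other parts among the k + 1 admissible values up to it; a
-- partition in 𝓗_d^(a) with k + 1 parts and largest part a + kd + r becomes, after removing
-- the forced gaps, a multiset of k values from r + 1. Both are counted by C(k + r, k), so with
-- Λφ = Σ_{k,r} φ(k,r) x^{kN+r} and g = Λ C = 1 / (1 - x - x^N) we get f_d^(c) = x^c g,
-- Σ_{𝓕^(a)} λ = x^a Λ((r+1) C) and Σ_{𝓗^(a)} λ = x^a Λ((k+1) C). By Pascal's rule these two
-- series solve h = u + x h + x^N h for u = 1 + x g and u = 1 + x^N g respectively, whose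
-- unique solutions are g + x g² and g + x^N g². The left-hand side is thus x^{a+1} g² - x^{a+N} g²,
-- and the two convolution sums on the right are exactly these coefficients.

{-# OPTIONS --safe #-}
module Submission where

open import Defs
open import Data.Nat using (ℕ; suc; _*_; _∸_; _≤_)
open import Data.Integer using (ℤ; +_; _-_)
open import Data.Integer using (_⊖_)
import Data.Integer.Properties as ℤP
open import Relation.Binary.PropositionalEquality using (_≡_)

open import Data.Nat using (zero; _+_; _<_; _%_; _<?_; _≤?_; z≤n; s≤s; z<s; s<s; NonZero; >-nonZero⁻¹)
open import Data.Nat.DivMod using (m<n⇒m%n≡m; n%n≡0; [m+n]%n≡m%n; [m+kn]%n≡m%n)
open import Data.Nat.Properties
open import Data.Nat.Induction using (<-rec)
open import Data.Nat.Tactic.RingSolver using (solve-∀)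
open import Data.List using (List; []; _∷_; map; applyUpTo; upTo; length; filter; concatMap; _++_)
open import Data.List.Properties using (map-applyUpTo; map-++; map-cong; map-∘)
open import Data.List.Relation.Unary.All as All using (All; []; _∷_)
open import Data.List.Relation.Unary.AllPairs using ([]; _∷_)
open import Data.Nat.ListAction using (sum)
open import Data.Nat.ListAction.Properties using (sum-++)
open import Data.Bool using (true; false; if_then_else_)
open import Data.Product using (_×_; _,_)
open import Data.Sum using (_⊎_; inj₁; inj₂)
open import Function using (_∘_; id; flip; _⇔_; mk⇔; Equivalence)
open import Relation.Nullary using (Dec; yes; no; does; _because_; ¬_; invert; contradiction)
open import Relation.Nullary.Decidable using (dec-true; dec-false; does-⇔; _×-dec_)
open import Relation.Unary using (Pred; Decidable)
open import Relation.Binary.PropositionalEquality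
  using (_≢_; refl; sym; trans; cong; cong₂; subst; _≗_; module ≡-Reasoning)

import Algebra.Properties.CommutativeSemigroup as CommSemigroupProperties
module +-CS = CommSemigroupProperties +-commutativeSemigroup
module *-CS = CommSemigroupProperties *-commutativeSemigroup

open ≡-Reasoning

m+n≡o⇒m<o : ∀ {i k s} → 0 < k → i + k ≡ s → i < s
m+n≡o⇒m<o {i} {k} k>0 refl = m<m+n i k>0

-- Finite sums

∑< : ℕ → (ℕ → ℕ) → ℕ
∑< zero    h = 0
∑< (suc n) h = h 0 + ∑< n (h ∘ suc)

∑₁ : ℕ → (ℕ → ℕ) → ℕ
∑₁ n φ = ∑< n (φ ∘ suc)

∑<-cong : ∀ n {h h′} → (∀ i → i < n → h i ≡ h′ i) → ∑< n h ≡ ∑< n h′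
∑<-cong zero    eq = refl
∑<-cong (suc n) eq = cong₂ _+_ (eq 0 z<s) (∑<-cong n (λ i i<n → eq (suc i) (s<s i<n)))

∑<-zero : ∀ n {h} → (∀ i → i < n → h i ≡ 0) → ∑< n h ≡ 0
∑<-zero zero    eq = refl
∑<-zero (suc n) eq = cong₂ _+_ (eq 0 z<s) (∑<-zero n (λ i i<n → eq (suc i) (s<s i<n)))

∑<-+ : ∀ n (h h′ : ℕ → ℕ) → ∑< n (λ i → h i + h′ i) ≡ ∑< n h + ∑< n h′
∑<-+ zero    h h′ = refl
∑<-+ (suc n) h h′ = begin
  (h 0 + h′ 0) + ∑< n (λ i → h (suc i) + h′ (suc i)) ≡⟨ cong (_+_ (h 0 + h′ 0)) (∑<-+ n _ _) ⟩
  (h 0 + h′ 0) + (∑< n (h ∘ suc) + ∑< n (h′ ∘ suc))  ≡⟨ +-CS.interchange (h 0) _ _ _ ⟩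
  (h 0 + ∑< n (h ∘ suc)) + (h′ 0 + ∑< n (h′ ∘ suc))  ∎

∑<-split : ∀ m n (h : ℕ → ℕ) → ∑< (m + n) h ≡ ∑< m h + ∑< n (λ i → h (m + i))
∑<-split zero    n h = refl
∑<-split (suc m) n h = trans (cong (_+_ (h 0)) (∑<-split m n (h ∘ suc))) (sym (+-assoc (h 0) _ _))

∑<-last : ∀ n (h : ℕ → ℕ) → ∑< (suc n) h ≡ ∑< n h + h n
∑<-last zero    h = +-identityʳ (h 0)
∑<-last (suc n) h = trans (cong (_+_ (h 0)) (∑<-last n (h ∘ suc))) (sym (+-assoc (h 0) _ _))

∑<-reverse : ∀ n (h : ℕ → ℕ) → ∑< n h ≡ ∑< n (λ i → h (n ∸ suc i))
∑<-reverse zero    h = refl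
∑<-reverse (suc n) h = begin
  h 0 + ∑< n (h ∘ suc)
    ≡⟨ cong (_+_ (h 0)) (∑<-reverse n (h ∘ suc)) ⟩
  h 0 + ∑< n (λ i → h (suc (n ∸ suc i)))
    ≡⟨ +-comm (h 0) _ ⟩
  ∑< n (λ i → h (suc (n ∸ suc i))) + h 0
    ≡⟨ cong (_+ h 0) (∑<-cong n (λ i i<n → cong h (sym (+-∸-assoc 1 i<n)))) ⟩
  ∑< n (λ i → h (n ∸ i)) + h 0
    ≡⟨ cong (λ x → ∑< n (λ i → h (n ∸ i)) + h x) (n∸n≡0 n) ⟨
  ∑< n (λ i → h (n ∸ i)) + h (n ∸ n)
    ≡⟨ ∑<-last n (λ i → h (n ∸ i)) ⟨
  ∑< (suc n) (λ i → h (suc n ∸ suc i))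
    ∎

∑₁-cong : ∀ n {φ ψ} → (∀ j → 1 ≤ j → j ≤ n → φ j ≡ ψ j) → ∑₁ n φ ≡ ∑₁ n ψ
∑₁-cong n eq = ∑<-cong n (λ i i<n → eq (suc i) (s≤s z≤n) i<n)

∑₁-split : ∀ m n (φ : ℕ → ℕ) → ∑₁ (m + n) φ ≡ ∑₁ m φ + ∑₁ n (λ j → φ (m + j))
∑₁-split m n φ = trans (∑<-split m n (φ ∘ suc))
  (cong (_+_ (∑₁ m φ)) (∑<-cong n (λ i _ → cong φ (sym (+-suc m i)))))

∑₁-single : ∀ {n c} (φ : ℕ → ℕ) → 1 ≤ c → c ≤ n → (∀ j → 1 ≤ j → j ≤ n → j ≢ c → φ j ≡ 0) →
            ∑₁ n φ ≡ φ c
∑₁-single {suc n} {suc zero} φ _ _ others = begin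
  φ 1 + ∑< n (φ ∘ suc ∘ suc)
    ≡⟨ cong (_+_ (φ 1)) (∑<-zero n λ i i<n → others (2 + i) (s≤s z≤n) (s≤s i<n) λ ()) ⟩
  φ 1 + 0
    ≡⟨ +-identityʳ (φ 1) ⟩
  φ 1
    ∎
∑₁-single {suc n} {suc (suc c)} φ _ (s≤s c<n) others = cong₂ _+_
  (others 1 ≤-refl (s≤s z≤n) λ ())
  (∑₁-single (φ ∘ suc) (s≤s z≤n) c<n λ j 1≤j j≤n j≢c →
     others (suc j) (s≤s z≤n) (s≤s j≤n) (j≢c ∘ suc-injective))

∑₁-extend : ∀ {n m} (φ : ℕ → ℕ) → n ≤ m → (∀ j → n < j → φ j ≡ 0) → ∑₁ m φ ≡ ∑₁ n φ
∑₁-extend {n} {m} φ n≤m vanish = begin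
  ∑₁ m φ
    ≡⟨ cong (λ m → ∑₁ m φ) (m+[n∸m]≡n n≤m) ⟨
  ∑₁ (n + (m ∸ n)) φ
    ≡⟨ ∑₁-split n (m ∸ n) φ ⟩
  ∑₁ n φ + ∑₁ (m ∸ n) (λ j → φ (n + j))
    ≡⟨ cong (_+_ (∑₁ n φ)) (∑<-zero (m ∸ n) λ i _ → vanish (n + suc i) (m<m+n n z<s)) ⟩
  ∑₁ n φ + 0
    ≡⟨ +-identityʳ _ ⟩
  ∑₁ n φ
    ∎

∑₁-antidiagonal : ∀ n (φ : ℕ → ℕ → ℕ) → ∑₁ n (λ j → φ j (n ∸ j)) ≡ ∑< n (λ r → φ (n ∸ r) r)
∑₁-antidiagonal n φ = trans (∑<-reverse n (λ i → φ (suc i) (n ∸ suc i))) (∑<-cong n mirror)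
  where
  mirror : ∀ r → r < n → φ (suc (n ∸ suc r)) (n ∸ suc (n ∸ suc r)) ≡ φ (n ∸ r) r
  mirror r r<n rewrite sym (+-∸-assoc 1 r<n) = cong (φ (n ∸ r)) (m∸[m∸n]≡n (<⇒≤ r<n))

sum-applyUpTo : ∀ n (h : ℕ → ℕ) → sum (applyUpTo h n) ≡ ∑< n h
sum-applyUpTo zero    h = refl
sum-applyUpTo (suc n) h = cong (_+_ (h 0)) (sum-applyUpTo n (h ∘ suc))

sum-range1 : ∀ n (φ : ℕ → ℕ) → sum (map φ (range1 n)) ≡ ∑₁ n φ
sum-range1 n φ = begin
  sum (map φ (map suc (upTo n))) ≡⟨ cong (sum ∘ map φ) (map-applyUpTo id suc n) ⟩
  sum (map φ (applyUpTo suc n))  ≡⟨ cong sum (map-applyUpTo suc φ n) ⟩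
  sum (applyUpTo (φ ∘ suc) n)    ≡⟨ sum-applyUpTo n (φ ∘ suc) ⟩
  ∑₁ n φ                         ∎

⟦_⟧ : ∀ {p} {P : Set p} → Dec P → ℕ
⟦ P? ⟧ = if does P? then 1 else 0

module _ {p} {P : Set p} where

  ⟦⟧-true : (P? : Dec P) → P → ⟦ P? ⟧ ≡ 1
  ⟦⟧-true P? x = cong (λ b → if b then 1 else 0) (dec-true P? x)

  ⟦⟧-false : (P? : Dec P) → ¬ P → ⟦ P? ⟧ ≡ 0
  ⟦⟧-false P? ¬x = cong (λ b → if b then 1 else 0) (dec-false P? ¬x)

  ⟦⟧-*-cong : ∀ {m n} (P? : Dec P) → (P → m ≡ n) → ⟦ P? ⟧ * m ≡ ⟦ P? ⟧ * n
  ⟦⟧-*-cong (true  because [x]) eq = cong (1 *_) (eq (invert [x]))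
  ⟦⟧-*-cong (false because _)   eq = refl

  module _ {q} {Q : Set q} where

    ⟦⟧-⇔ : P ⇔ Q → (P? : Dec P) (Q? : Dec Q) → ⟦ P? ⟧ ≡ ⟦ Q? ⟧
    ⟦⟧-⇔ P⇔Q P? Q? = cong (λ b → if b then 1 else 0) (does-⇔ P⇔Q P? Q?)

    ⟦⟧-× : (P? : Dec P) (Q? : Dec Q) → ⟦ P? ×-dec Q? ⟧ ≡ ⟦ P? ⟧ * ⟦ Q? ⟧
    ⟦⟧-× (true  because _) (true  because _) = refl
    ⟦⟧-× (true  because _) (false because _) = refl
    ⟦⟧-× (false because _) _                 = refl

-- Power series over ℕ

-- delay k h is the power series x^k · h.
delay : ℕ → (ℕ → ℕ) → ℕ → ℕ
delay zero    h s       = h s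
delay (suc k) h zero    = 0
delay (suc k) h (suc s) = delay k h s

infixl 6 _⊕_
_⊕_ : (ℕ → ℕ) → (ℕ → ℕ) → ℕ → ℕ
(h ⊕ h′) s = h s + h′ s

infixl 7 _⊛_
_⊛_ : (ℕ → ℕ) → (ℕ → ℕ) → ℕ → ℕ
(a ⊛ b) t = ∑< (suc t) (λ i → a i * b (t ∸ i))

unit : ℕ → ℕ
unit zero    = 1
unit (suc _) = 0

delay-∸ : ∀ {k n} (h : ℕ → ℕ) → k ≤ n → delay k h n ≡ h (n ∸ k)
delay-∸ {zero}           h _         = refl
delay-∸ {suc k} {suc n}  h (s≤s k≤n) = delay-∸ h k≤n

delay-below : ∀ {k s} (h : ℕ → ℕ) → s < k → delay k h s ≡ 0
delay-below {suc k} {zero}  h _         = refl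
delay-below {suc k} {suc s} h (s<s s<k) = delay-below h s<k

delay-0 : ∀ k s → delay k (λ _ → 0) s ≡ 0
delay-0 zero    s       = refl
delay-0 (suc k) zero    = refl
delay-0 (suc k) (suc s) = delay-0 k s

delay-cong : ∀ k {h h′ s} → (∀ i → i + k ≡ s → h i ≡ h′ i) → delay k h s ≡ delay k h′ s
delay-cong zero    {s = s}     eq = eq s (+-identityʳ s)
delay-cong (suc k) {s = zero}  eq = refl
delay-cong (suc k) {s = suc s} eq = delay-cong k λ i i+k≡s → eq i (trans (+-suc i k) (cong suc i+k≡s))

delay-+ : ∀ m n (h : ℕ → ℕ) → delay (m + n) h ≗ delay m (delay n h)
delay-+ zero    n h s       = refl
delay-+ (suc m) n h zero    = refl
delay-+ (suc m) n h (suc s) = delay-+ m n h s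

delay-comm : ∀ m n (h : ℕ → ℕ) → delay m (delay n h) ≗ delay n (delay m h)
delay-comm m n h s = begin
  delay m (delay n h) s ≡⟨ delay-+ m n h s ⟨
  delay (m + n) h s     ≡⟨ cong (λ k → delay k h s) (+-comm m n) ⟩
  delay (n + m) h s     ≡⟨ delay-+ n m h s ⟩
  delay n (delay m h) s ∎

delay-⊕ : ∀ k (h h′ : ℕ → ℕ) → delay k (h ⊕ h′) ≗ delay k h ⊕ delay k h′
delay-⊕ zero    h h′ s       = refl
delay-⊕ (suc k) h h′ zero    = refl
delay-⊕ (suc k) h h′ (suc s) = delay-⊕ k h h′ s

delay-*ˡ : ∀ k c (h : ℕ → ℕ) s → delay k (λ t → c * h t) s ≡ c * delay k h s
delay-*ˡ zero    c h s       = refl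
delay-*ˡ (suc k) c h zero    = sym (*-zeroʳ c)
delay-*ˡ (suc k) c h (suc s) = delay-*ˡ k c h s

delay-∑< : ∀ k n (F : ℕ → ℕ → ℕ) s → delay k (λ t → ∑< n (λ i → F i t)) s ≡ ∑< n (λ i → delay k (F i) s)
delay-∑< zero    n F s       = refl
delay-∑< (suc k) n F zero    = sym (∑<-zero n λ _ _ → refl)
delay-∑< (suc k) n F (suc s) = delay-∑< k n F s

∑≤-delay : ∀ m (h : ℕ → ℕ) u → ∑< (suc u) (delay m h) ≡ delay m (λ v → ∑< (suc v) h) u
∑≤-delay zero    h u       = refl
∑≤-delay (suc m) h zero    = refl
∑≤-delay (suc m) h (suc u) = ∑≤-delay m h u

⊛-congˡ : ∀ {a a′ : ℕ → ℕ} b → a ≗ a′ → a ⊛ b ≗ a′ ⊛ b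
⊛-congˡ b eq t = ∑<-cong (suc t) λ i _ → cong (_* b (t ∸ i)) (eq i)

⊕-⊛ : ∀ (a a′ b : ℕ → ℕ) → (a ⊕ a′) ⊛ b ≗ a ⊛ b ⊕ a′ ⊛ b
⊕-⊛ a a′ b t = trans (∑<-cong (suc t) λ i _ → *-distribʳ-+ (b (t ∸ i)) (a i) (a′ i))
                     (∑<-+ (suc t) (λ i → a i * b (t ∸ i)) (λ i → a′ i * b (t ∸ i)))

unit-⊛ : ∀ (b : ℕ → ℕ) → unit ⊛ b ≗ b
unit-⊛ b t = trans (cong₂ _+_ (*-identityˡ (b t)) (∑<-zero t λ _ _ → refl)) (+-identityʳ (b t))

delay-⊛ : ∀ k (a b : ℕ → ℕ) → delay k a ⊛ b ≗ delay k (a ⊛ b)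
delay-⊛ zero    a b t       = refl
delay-⊛ (suc k) a b zero    = refl
delay-⊛ (suc k) a b (suc t) = delay-⊛ k a b t

⊛-comm : ∀ (a b : ℕ → ℕ) → a ⊛ b ≗ b ⊛ a
⊛-comm a b t = begin
  ∑< (suc t) (λ i → a i * b (t ∸ i))
    ≡⟨ ∑<-reverse (suc t) (λ i → a i * b (t ∸ i)) ⟩
  ∑< (suc t) (λ i → a (t ∸ i) * b (t ∸ (t ∸ i)))
    ≡⟨ ∑<-cong (suc t) (λ i i≤t → cong (a (t ∸ i) *_) (cong b (m∸[m∸n]≡n (≤-pred i≤t)))) ⟩
  ∑< (suc t) (λ i → a (t ∸ i) * b i)
    ≡⟨ ∑<-cong (suc t) (λ i _ → *-comm (a (t ∸ i)) (b i)) ⟩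
  ∑< (suc t) (λ i → b i * a (t ∸ i))
    ∎

⊛-delay : ∀ k (a b : ℕ → ℕ) → a ⊛ delay k b ≗ delay k (a ⊛ b)
⊛-delay k a b t = begin
  (a ⊛ delay k b) t   ≡⟨ ⊛-comm a (delay k b) t ⟩
  (delay k b ⊛ a) t   ≡⟨ delay-⊛ k b a t ⟩
  delay k (b ⊛ a) t   ≡⟨ delay-cong k (λ i _ → ⊛-comm b a i) ⟩
  delay k (a ⊛ b) t   ∎

Σ1to-⊛ : ∀ n (a b : ℕ → ℕ) → a 0 ≡ 0 → b 0 ≡ 0 → Σ1to (n ∸ 1) (λ m → b (n ∸ m) * a m) ≡ (a ⊛ b) n
Σ1to-⊛ zero    a b a0 b0 = sym (trans (+-identityʳ _) (cong (_* b 0) a0))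
Σ1to-⊛ (suc n) a b a0 b0 = sym (begin
  (a ⊛ b) (suc n)
    ≡⟨ cong₂ _+_ (cong (_* b (suc n)) a0) (∑<-last n (λ i → a (suc i) * b (n ∸ i))) ⟩
  ∑< n (λ i → a (suc i) * b (n ∸ i)) + a (suc n) * b (n ∸ n)
    ≡⟨ cong (λ x → ∑< n (λ i → a (suc i) * b (n ∸ i)) + a (suc n) * b x) (n∸n≡0 n) ⟩
  ∑< n (λ i → a (suc i) * b (n ∸ i)) + a (suc n) * b 0
    ≡⟨ cong (λ x → ∑< n (λ i → a (suc i) * b (n ∸ i)) + a (suc n) * x) b0 ⟩
  ∑< n (λ i → a (suc i) * b (n ∸ i)) + a (suc n) * 0
    ≡⟨ trans (cong (_+_ (∑< n _)) (*-zeroʳ (a (suc n)))) (+-identityʳ _) ⟩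
  ∑< n (λ i → a (suc i) * b (n ∸ i))
    ≡⟨ ∑<-cong n (λ i _ → *-comm (a (suc i)) _) ⟩
  ∑< n (λ i → b (n ∸ i) * a (suc i))
    ≡⟨ sum-range1 n _ ⟨
  Σ1to n (λ m → b (suc n ∸ m) * a m)
    ∎)

⟦≤⟧-delay : ∀ {a m} j (h : ℕ → ℕ) → a ≤ m → ⟦ a ≤? j ⟧ * delay m h j ≡ delay m h j
⟦≤⟧-delay {a} {m} j h a≤m = by-cases (≤-<-connex a j)
  where
  by-cases : a ≤ j ⊎ j < a → ⟦ a ≤? j ⟧ * delay m h j ≡ delay m h j
  by-cases (inj₁ a≤j) = trans (cong (_* delay m h j) (⟦⟧-true (a ≤? j) a≤j)) (*-identityˡ _)
  by-cases (inj₂ j<a) = trans (cong (_* delay m h j) (⟦⟧-false (a ≤? j) (<⇒≱ j<a)))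
                              (sym (delay-below h (<-≤-trans j<a a≤m)))

∑₁-window : ∀ d j (h : ℕ → ℕ) → h 0 ≡ 0 →
            ∑₁ j (λ i → ⟦ i + d ≤? j ⟧ * h i) ≡ delay d (λ u → ∑< (suc u) h) j
∑₁-window d j h h0 = by-cases (≤-<-connex d j)
  where
  φ : ℕ → ℕ
  φ i = ⟦ i + d ≤? j ⟧ * h i
  by-cases : d ≤ j ⊎ j < d → ∑₁ j φ ≡ delay d (λ u → ∑< (suc u) h) j
  by-cases (inj₂ j<d) = trans
    (∑<-zero j λ i _ → cong (_* h (suc i))
       (⟦⟧-false (suc i + d ≤? j) λ le → <⇒≱ j<d (≤-trans (m≤n+m d (suc i)) le)))
    (sym (delay-below _ j<d))
  by-cases (inj₁ d≤j) = begin
    ∑₁ j φ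
      ≡⟨ cong (_+ ∑₁ j φ) (trans (cong (⟦ d ≤? j ⟧ *_) h0) (*-zeroʳ ⟦ d ≤? j ⟧)) ⟨
    ∑< (suc j) φ
      ≡⟨ cong (λ m → ∑< (suc m) φ) (m∸n+n≡m d≤j) ⟨
    ∑< (suc u + d) φ
      ≡⟨ ∑<-split (suc u) d φ ⟩
    ∑< (suc u) φ + ∑< d (λ t → φ (suc u + t))
      ≡⟨ cong₂ _+_ (∑<-cong (suc u) inside) (∑<-zero d outside) ⟩
    ∑< (suc u) h + 0
      ≡⟨ +-identityʳ _ ⟩
    ∑< (suc u) h
      ≡⟨ delay-∸ (λ v → ∑< (suc v) h) d≤j ⟨
    delay d (λ v → ∑< (suc v) h) j
      ∎
    where
    u : ℕ
    u = j ∸ d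
    inside : ∀ i → i < suc u → φ i ≡ h i
    inside i i≤u = trans
      (cong (_* h i) (⟦⟧-true (i + d ≤? j) (subst (i + d ≤_) (m∸n+n≡m d≤j) (+-monoˡ-≤ d (≤-pred i≤u)))))
      (*-identityˡ (h i))
    outside : ∀ t → t < d → φ (suc u + t) ≡ 0
    outside t _ = cong (_* h (suc u + t)) (⟦⟧-false (suc u + t + d ≤? j) (<⇒≱ j<))
      where
      j< : j < suc u + t + d
      j< = s≤s (subst (_≤ u + t + d) (m∸n+n≡m d≤j) (+-monoˡ-≤ d (m≤m+n u t)))

-- binom k r = C(k + r, k)
binom : ℕ → ℕ → ℕ
binom zero    r       = 1
binom (suc k) zero    = 1
binom (suc k) (suc r) = binom (suc k) r + binom k (suc r)

binom-zeroʳ : ∀ k → binom k 0 ≡ 1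
binom-zeroʳ zero    = refl
binom-zeroʳ (suc k) = refl

binom-sym : ∀ k r → binom k r ≡ binom r k
binom-sym zero    r       = sym (binom-zeroʳ r)
binom-sym (suc k) zero    = refl
binom-sym (suc k) (suc r) = trans (cong₂ _+_ (binom-sym (suc k) r) (binom-sym k (suc r)))
                                  (+-comm (binom r (suc k)) (binom (suc r) k))

binom-hockey : ∀ k r → binom k (suc r) ≡ ∑< (suc k) (λ i → binom i r)
binom-hockey zero    r = refl
binom-hockey (suc k) r = begin
  binom (suc k) r + binom k (suc r)               ≡⟨ cong (_+_ (binom (suc k) r)) (binom-hockey k r) ⟩
  binom (suc k) r + ∑< (suc k) (λ i → binom i r)  ≡⟨ +-comm (binom (suc k) r) _ ⟩
  ∑< (suc k) (λ i → binom i r) + binom (suc k) r  ≡⟨ ∑<-last (suc k) (λ i → binom i r) ⟨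
  ∑< (suc (suc k)) (λ i → binom i r)              ∎

unit₂ : ℕ → ℕ → ℕ
unit₂ zero    = unit
unit₂ (suc k) = λ _ → 0

below : (ℕ → ℕ → ℕ) → ℕ → ℕ → ℕ
below φ zero    = λ _ → 0
below φ (suc k) = φ k

weightF weightH : ℕ → ℕ → ℕ
weightF k r = suc r * binom k r
weightH k r = suc k * binom k r

binom-rec : ∀ k → binom k ≗ unit₂ k ⊕ delay 1 (binom k) ⊕ below binom k
binom-rec zero    zero    = refl
binom-rec zero    (suc r) = refl
binom-rec (suc k) zero    = sym (binom-zeroʳ k)
binom-rec (suc k) (suc r) = refl

weightF-rec : ∀ k → weightF k ≗ (unit₂ k ⊕ delay 1 (binom k)) ⊕ delay 1 (weightF k) ⊕ below weightF k
weightF-rec zero    zero    = refl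
weightF-rec zero    (suc r) = edge r
  where
  edge : ∀ r → suc (suc r) * 1 ≡ 1 + suc r * 1 + 0
  edge = solve-∀
weightF-rec (suc k) zero    = cong (_+ 0) (sym (binom-zeroʳ k))
weightF-rec (suc k) (suc r) = pascal r (binom (suc k) r) (binom k (suc r))
  where
  pascal : ∀ r A B → suc (suc r) * (A + B) ≡ A + suc r * A + suc (suc r) * B
  pascal = solve-∀

weightH-rec : ∀ k → weightH k ≗ (unit₂ k ⊕ below binom k) ⊕ delay 1 (weightH k) ⊕ below weightH k
weightH-rec zero    zero    = refl
weightH-rec zero    (suc r) = refl
weightH-rec (suc k) zero    = trans (edge k) (cong (λ b → b + 0 + suc k * b) (sym (binom-zeroʳ k)))
  where
  edge : ∀ k → suc (suc k) * 1 ≡ 1 + 0 + suc k * 1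
  edge = solve-∀
weightH-rec (suc k) (suc r) = pascal k (binom (suc k) r) (binom k (suc r))
  where
  pascal : ∀ k A B → suc (suc k) * (A + B) ≡ B + suc (suc k) * A + suc k * B
  pascal = solve-∀

module Series (N : ℕ) .{{_ : NonZero N}} where

  -- Solves u h says h = u / (1 - x - x^N).
  Solves : (ℕ → ℕ) → (ℕ → ℕ) → Set
  Solves u h = h ≗ u ⊕ delay 1 h ⊕ delay N h

  solves-unique : ∀ {u h h′} → Solves u h → Solves u h′ → h ≗ h′
  solves-unique {u} {h} {h′} sol sol′ = <-rec (λ s → h s ≡ h′ s) step
    where
    step : ∀ s → (∀ {i} → i < s → h i ≡ h′ i) → h s ≡ h′ s
    step s ih = begin
      h s
        ≡⟨ sol s ⟩
      u s + delay 1 h s + delay N h s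
        ≡⟨ cong₂ (λ x y → u s + x + y) (delay-cong 1 λ i e → ih (m+n≡o⇒m<o z<s e))
                                        (delay-cong N λ i e → ih (m+n≡o⇒m<o (>-nonZero⁻¹ N) e)) ⟩
      u s + delay 1 h′ s + delay N h′ s
        ≡⟨ sol′ s ⟨
      h′ s
        ∎

  solves-congˡ : ∀ {u u′ h} → u ≗ u′ → Solves u h → Solves u′ h
  solves-congˡ eq sol s = trans (sol s) (cong (λ x → x + _ + _) (eq s))

  solves-⊕ : ∀ {u h v k} → Solves u h → Solves v k → Solves (u ⊕ v) (h ⊕ k)
  solves-⊕ {u} {h} {v} {k} solh solk s = begin
    h s + k s
      ≡⟨ cong₂ _+_ (solh s) (solk s) ⟩
    (u s + delay 1 h s + delay N h s) + (v s + delay 1 k s + delay N k s)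
      ≡⟨ regroup (u s) (v s) _ _ _ _ ⟩
    (u s + v s) + (delay 1 h s + delay 1 k s) + (delay N h s + delay N k s)
      ≡⟨ cong₂ (λ x y → (u s + v s) + x + y) (delay-⊕ 1 h k s) (delay-⊕ N h k s) ⟨
    (u s + v s) + delay 1 (h ⊕ k) s + delay N (h ⊕ k) s
      ∎
    where
    regroup : ∀ a a′ b b′ c c′ → (a + b + c) + (a′ + b′ + c′) ≡ (a + a′) + (b + b′) + (c + c′)
    regroup = solve-∀

  solves-delay : ∀ m {u h} → Solves u h → Solves (delay m u) (delay m h)
  solves-delay m {u} {h} sol s = begin
    delay m h s                                           ≡⟨ delay-cong m (λ i _ → sol i) ⟩
    delay m (u ⊕ delay 1 h ⊕ delay N h) s                 ≡⟨ delay-⊕ m (u ⊕ delay 1 h) (delay N h) s ⟩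
    delay m (u ⊕ delay 1 h) s + delay m (delay N h) s     ≡⟨ cong (_+ _) (delay-⊕ m u (delay 1 h) s) ⟩
    delay m u s + delay m (delay 1 h) s + delay m (delay N h) s
      ≡⟨ cong₂ (λ x y → delay m u s + x + y) (delay-comm m 1 h s) (delay-comm m N h s) ⟩
    delay m u s + delay 1 (delay m h) s + delay N (delay m h) s  ∎

  solves-⊛ : ∀ {u h} → Solves u h → ∀ b → Solves (u ⊛ b) (h ⊛ b)
  solves-⊛ {u} {h} sol b t = begin
    (h ⊛ b) t
      ≡⟨ ⊛-congˡ b sol t ⟩
    ((u ⊕ delay 1 h ⊕ delay N h) ⊛ b) t
      ≡⟨ ⊕-⊛ (u ⊕ delay 1 h) (delay N h) b t ⟩
    ((u ⊕ delay 1 h) ⊛ b) t + (delay N h ⊛ b) t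
      ≡⟨ cong₂ _+_ (⊕-⊛ u (delay 1 h) b t) (delay-⊛ N h b t) ⟩
    (u ⊛ b) t + (delay 1 h ⊛ b) t + delay N (h ⊛ b) t
      ≡⟨ cong (λ x → (u ⊛ b) t + x + delay N (h ⊛ b) t) (delay-⊛ 1 h b t) ⟩
    (u ⊛ b) t + delay 1 (h ⊛ b) t + delay N (h ⊛ b) t
      ∎

  -- Λₘ M φ = Σ_{k<M} x^{kN} φ k; only the terms k ≤ s reach the coefficient of x^s.
  Λₘ : ℕ → (ℕ → ℕ → ℕ) → ℕ → ℕ
  Λₘ M φ s = ∑< M (λ k → delay (k * N) (φ k) s)

  Λ : (ℕ → ℕ → ℕ) → ℕ → ℕ
  Λ φ s = Λₘ (suc s) φ s

  Λₘ-trunc : ∀ (φ : ℕ → ℕ → ℕ) {M s} → s < M → Λₘ M φ s ≡ Λ φ s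
  Λₘ-trunc φ {M} {s} s<M = begin
    Λₘ M φ s                      ≡⟨ cong (λ M → Λₘ M φ s) (m+[n∸m]≡n s<M) ⟨
    Λₘ (suc s + (M ∸ suc s)) φ s  ≡⟨ ∑<-split (suc s) (M ∸ suc s) (λ k → delay (k * N) (φ k) s) ⟩
    Λ φ s + ∑< (M ∸ suc s) late   ≡⟨ cong (_+_ (Λ φ s)) (∑<-zero (M ∸ suc s) λ i _ → vanish i) ⟩
    Λ φ s + 0                     ≡⟨ +-identityʳ _ ⟩
    Λ φ s                         ∎
    where
    late : ℕ → ℕ
    late i = delay ((suc s + i) * N) (φ (suc s + i)) s
    vanish : ∀ i → late i ≡ 0
    vanish i = delay-below (φ (suc s + i)) (≤-trans (m≤m+n (suc s) i) (m≤m*n (suc s + i) N))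

  Λₘ-suc : ∀ M (φ : ℕ → ℕ → ℕ) s → Λₘ (suc M) φ s ≡ φ 0 s + delay N (Λₘ M (φ ∘ suc)) s
  Λₘ-suc M φ s = cong (_+_ (φ 0 s)) (begin
    ∑< M (λ k → delay (N + k * N) (φ (suc k)) s)
      ≡⟨ ∑<-cong M (λ k _ → delay-+ N (k * N) (φ (suc k)) s) ⟩
    ∑< M (λ k → delay N (delay (k * N) (φ (suc k))) s)
      ≡⟨ delay-∑< N M (λ k → delay (k * N) (φ (suc k))) s ⟨
    delay N (Λₘ M (φ ∘ suc)) s
      ∎)

  Λ-peel : ∀ (φ : ℕ → ℕ → ℕ) s → Λ φ s ≡ φ 0 s + delay N (Λ (φ ∘ suc)) s
  Λ-peel φ s = trans (Λₘ-suc s φ s) (cong (_+_ (φ 0 s))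
    (delay-cong N λ i e → Λₘ-trunc (φ ∘ suc) (m+n≡o⇒m<o (>-nonZero⁻¹ N) e)))

  Λ-cong : ∀ {φ ψ : ℕ → ℕ → ℕ} → (∀ k → φ k ≗ ψ k) → Λ φ ≗ Λ ψ
  Λ-cong eq s = ∑<-cong (suc s) λ k _ → delay-cong (k * N) {s = s} λ i _ → eq k i

  Λ-⊕ : ∀ (φ ψ : ℕ → ℕ → ℕ) → Λ (λ k → φ k ⊕ ψ k) ≗ Λ φ ⊕ Λ ψ
  Λ-⊕ φ ψ s = trans (∑<-cong (suc s) λ k _ → delay-⊕ (k * N) (φ k) (ψ k) s)
                    (∑<-+ (suc s) (λ k → delay (k * N) (φ k) s) (λ k → delay (k * N) (ψ k) s))

  Λₘ-delay : ∀ M m (φ : ℕ → ℕ → ℕ) → Λₘ M (λ k → delay m (φ k)) ≗ delay m (Λₘ M φ)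
  Λₘ-delay M m φ s = begin
    ∑< M (λ k → delay (k * N) (delay m (φ k)) s)   ≡⟨ ∑<-cong M (λ k _ → delay-comm (k * N) m (φ k) s) ⟩
    ∑< M (λ k → delay m (delay (k * N) (φ k)) s)   ≡⟨ delay-∑< m M (λ k → delay (k * N) (φ k)) s ⟨
    delay m (Λₘ M φ) s                             ∎

  Λ-delay : ∀ m (φ : ℕ → ℕ → ℕ) → Λ (λ k → delay m (φ k)) ≗ delay m (Λ φ)
  Λ-delay m φ s = trans (Λₘ-delay (suc s) m φ s)
    (delay-cong m λ i e → Λₘ-trunc φ (s≤s (subst (i ≤_) e (m≤m+n i m))))

  Λ-below : ∀ (φ : ℕ → ℕ → ℕ) → Λ (below φ) ≗ delay N (Λ φ)
  Λ-below φ = Λ-peel (below φ)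

  Λ-unit₂ : Λ unit₂ ≗ unit
  Λ-unit₂ s = trans (Λ-peel unit₂ s)
    (trans (cong (_+_ (unit s)) (trans (delay-cong N λ i _ → ∑<-zero (suc i) λ k _ → delay-0 (k * N) i)
                                        (delay-0 N s)))
           (+-identityʳ (unit s)))

  Λ-solves : ∀ {φ ψ : ℕ → ℕ → ℕ} → (∀ k → φ k ≗ ψ k ⊕ delay 1 (φ k) ⊕ below φ k) → Solves (Λ ψ) (Λ φ)
  Λ-solves {φ} {ψ} rec s = begin
    Λ φ s
      ≡⟨ Λ-cong rec s ⟩
    Λ (λ k → ψ k ⊕ delay 1 (φ k) ⊕ below φ k) s
      ≡⟨ Λ-⊕ (λ k → ψ k ⊕ delay 1 (φ k)) (below φ) s ⟩
    Λ (λ k → ψ k ⊕ delay 1 (φ k)) s + Λ (below φ) s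
      ≡⟨ cong₂ _+_ (Λ-⊕ ψ (λ k → delay 1 (φ k)) s) (Λ-below φ s) ⟩
    Λ ψ s + Λ (λ k → delay 1 (φ k)) s + delay N (Λ φ) s
      ≡⟨ cong (λ x → Λ ψ s + x + delay N (Λ φ) s) (Λ-delay 1 φ s) ⟩
    Λ ψ s + delay 1 (Λ φ) s + delay N (Λ φ) s
      ∎

  g : ℕ → ℕ
  g = Λ binom

  conv : ℕ → ℕ
  conv = g ⊛ g

  g-solves : Solves unit g
  g-solves = solves-congˡ Λ-unit₂ (Λ-solves binom-rec)

  conv-solves : Solves g conv
  conv-solves = solves-congˡ (unit-⊛ g) (solves-⊛ g-solves g)

  g⊕conv-solves : ∀ m → Solves (unit ⊕ delay m g) (g ⊕ delay m conv)
  g⊕conv-solves m = solves-⊕ g-solves (solves-delay m conv-solves)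

  ΛweightF≗ : Λ weightF ≗ g ⊕ delay 1 conv
  ΛweightF≗ = solves-unique (solves-congˡ source (Λ-solves weightF-rec)) (g⊕conv-solves 1)
    where
    source : Λ (λ k → unit₂ k ⊕ delay 1 (binom k)) ≗ unit ⊕ delay 1 g
    source s = trans (Λ-⊕ unit₂ (λ k → delay 1 (binom k)) s) (cong₂ _+_ (Λ-unit₂ s) (Λ-delay 1 binom s))

  ΛweightH≗ : Λ weightH ≗ g ⊕ delay N conv
  ΛweightH≗ = solves-unique (solves-congˡ source (Λ-solves weightH-rec)) (g⊕conv-solves N)
    where
    source : Λ (λ k → unit₂ k ⊕ below binom k) ≗ unit ⊕ delay N g
    source s = trans (Λ-⊕ unit₂ (below binom) s) (cong₂ _+_ (Λ-unit₂ s) (Λ-below binom s))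

-- Enumerating partitions

sum-map-filter : ∀ {a p} {A : Set a} {P : Pred A p} (P? : Decidable P) (w : A → ℕ) xs →
                 sum (map w (filter P? xs)) ≡ sum (map (λ x → ⟦ P? x ⟧ * w x) xs)
sum-map-filter P? w []       = refl
sum-map-filter P? w (x ∷ xs) with does (P? x)
... | true  = cong₂ _+_ (sym (+-identityʳ (w x))) (sum-map-filter P? w xs)
... | false = sum-map-filter P? w xs

sum-map-*ˡ : ∀ {a} {A : Set a} c (w : A → ℕ) xs → sum (map (λ x → c * w x) xs) ≡ c * sum (map w xs)
sum-map-*ˡ c w []       = sym (*-zeroʳ c)
sum-map-*ˡ c w (x ∷ xs) = trans (cong (_+_ (c * w x)) (sum-map-*ˡ c w xs)) (sym (*-distribˡ-+ c (w x) _))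

sum-map-concatMap : ∀ {a b} {A : Set a} {B : Set b} (w : B → ℕ) (G : A → List B) xs →
                    sum (map w (concatMap G xs)) ≡ sum (map (λ x → sum (map w (G x))) xs)
sum-map-concatMap w G []       = refl
sum-map-concatMap w G (x ∷ xs) = begin
  sum (map w (G x ++ concatMap G xs))
    ≡⟨ cong sum (map-++ w (G x) _) ⟩
  sum (map w (G x) ++ map w (concatMap G xs))
    ≡⟨ sum-++ (map w (G x)) _ ⟩
  sum (map w (G x)) + sum (map w (concatMap G xs))
    ≡⟨ cong (_+_ (sum (map w (G x)))) (sum-map-concatMap w G xs) ⟩
  sum (map w (G x)) + sum (map (λ x → sum (map w (G x))) xs)
    ∎

sum-map-0 : ∀ {a} {A : Set a} (xs : List A) → sum (map (λ _ → 0) xs) ≡ 0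
sum-map-0 []       = refl
sum-map-0 (x ∷ xs) = sum-map-0 xs

length≡sum-map-1 : ∀ {a} {A : Set a} (xs : List A) → length xs ≡ sum (map (λ _ → 1) xs)
length≡sum-map-1 []       = refl
length≡sum-map-1 (x ∷ xs) = cong suc (length≡sum-map-1 xs)

∑gen : ℕ → ℕ → (List ℕ → ℕ) → ℕ
∑gen L k w = sum (map w (gen L k))

∑gen-suc : ∀ L k w → ∑gen (suc L) k w ≡ w [] + ∑₁ k (λ j → ∑gen L j (w ∘ (j ∷_)))
∑gen-suc L k w = cong (_+_ (w [])) (begin
  sum (map w (concatMap (λ j → map (j ∷_) (gen L j)) (range1 k)))
    ≡⟨ sum-map-concatMap w (λ j → map (j ∷_) (gen L j)) (range1 k) ⟩
  sum (map (λ j → sum (map w (map (j ∷_) (gen L j)))) (range1 k))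
    ≡⟨ cong sum (map-cong (λ j → cong sum (sym (map-∘ (gen L j)))) (range1 k)) ⟩
  sum (map (λ j → ∑gen L j (w ∘ (j ∷_))) (range1 k))
    ≡⟨ sum-range1 k _ ⟩
  ∑₁ k (λ j → ∑gen L j (w ∘ (j ∷_)))
    ∎)

∑gen-*ˡ : ∀ L k c w → ∑gen L k (λ τ → c * w τ) ≡ c * ∑gen L k w
∑gen-*ˡ L k c w = sum-map-*ˡ c w (gen L k)

∑gen-≗ : ∀ L k {w w′} → w ≗ w′ → ∑gen L k w ≡ ∑gen L k w′
∑gen-≗ L k eq = cong sum (map-cong eq (gen L k))

BoundedPartition : ℕ → List ℕ → Set
BoundedPartition k τ = IsPartition τ × All (_≤ k) τ

cons-partition : ∀ {j τ} → 1 ≤ j → BoundedPartition j τ → IsPartition (j ∷ τ)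
cons-partition 1≤j ((pos , desc) , τ≤j) = (1≤j ∷ pos) , (τ≤j ∷ desc)

∑gen-cong : ∀ L k {w w′} → (∀ τ → BoundedPartition k τ → w τ ≡ w′ τ) → ∑gen L k w ≡ ∑gen L k w′
∑gen-cong zero    k eq = cong (_+ 0) (eq [] (([] , []) , []))
∑gen-cong (suc L) k {w} {w′} eq = begin
  ∑gen (suc L) k w
    ≡⟨ ∑gen-suc L k w ⟩
  w [] + ∑₁ k (λ j → ∑gen L j (w ∘ (j ∷_)))
    ≡⟨ cong₂ _+_ (eq [] (([] , []) , [])) (∑₁-cong k λ j 1≤j j≤k →
        ∑gen-cong L j λ τ bτ → eq (j ∷ τ) (cons-partition 1≤j bτ , bounded j≤k bτ)) ⟩
  w′ [] + ∑₁ k (λ j → ∑gen L j (w′ ∘ (j ∷_)))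
    ≡⟨ ∑gen-suc L k w′ ⟨
  ∑gen (suc L) k w′
    ∎
  where
  bounded : ∀ {j τ} → j ≤ k → BoundedPartition j τ → All (_≤ k) (j ∷ τ)
  bounded j≤k (_ , τ≤j) = j≤k ∷ All.map (λ i≤j → ≤-trans i≤j j≤k) τ≤j

-- The number of lists B ≥ x₁ ≥ ⋯ ≥ x_r ≥ 1 in which each step y → x (with x₀ = B) is
-- weighted by κ y x.
count : (ℕ → ℕ → ℕ) → ℕ → ℕ → ℕ
count κ B zero    = 1
count κ B (suc r) = ∑₁ B (λ x → κ B x * count κ x r)

record ChainWeight (κ : ℕ → ℕ → ℕ) (w : ℕ → ℕ → List ℕ → ℕ) : Set where
  field
    nil-zero  : ∀ B → w B 0 [] ≡ 1
    cons-zero : ∀ B x τ → w B 0 (x ∷ τ) ≡ 0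
    nil-suc   : ∀ B r → w B (suc r) [] ≡ 0
    cons-suc  : ∀ B r x τ → w B (suc r) (x ∷ τ) ≡ κ B x * w x r τ

∑gen-chain : ∀ {κ w} → ChainWeight κ w → ∀ {r L} B → r ≤ L → ∑gen L B (w B r) ≡ count κ B r
∑gen-chain cw {zero} {zero} B _ = trans (+-identityʳ _) (nil-zero B)
  where open ChainWeight cw
∑gen-chain {κ} {w} cw {zero} {suc L} B _ = begin
  ∑gen (suc L) B (w B 0)
    ≡⟨ ∑gen-suc L B (w B 0) ⟩
  w B 0 [] + ∑₁ B (λ j → ∑gen L j (w B 0 ∘ (j ∷_)))
    ≡⟨ cong₂ _+_ (nil-zero B) (∑<-zero B λ i _ →
        trans (∑gen-≗ L (suc i) (cons-zero B (suc i))) (sum-map-0 (gen L (suc i)))) ⟩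
  1 + 0
    ∎
  where open ChainWeight cw
∑gen-chain {κ} {w} cw {suc r} {suc L} B (s≤s r≤L) = begin
  ∑gen (suc L) B (w B (suc r))
    ≡⟨ ∑gen-suc L B (w B (suc r)) ⟩
  w B (suc r) [] + ∑₁ B (λ j → ∑gen L j (w B (suc r) ∘ (j ∷_)))
    ≡⟨ cong₂ _+_ (nil-suc B r) (∑₁-cong B λ j _ _ → step j) ⟩
  0 + count κ B (suc r)
    ∎
  where
  open ChainWeight cw
  step : ∀ j → ∑gen L j (w B (suc r) ∘ (j ∷_)) ≡ κ B j * count κ j r
  step j = begin
    ∑gen L j (w B (suc r) ∘ (j ∷_))       ≡⟨ ∑gen-≗ L j (cons-suc B r j) ⟩
    ∑gen L j (λ τ → κ B j * w j r τ)      ≡⟨ ∑gen-*ˡ L j (κ B j) (w j r) ⟩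
    κ B j * ∑gen L j (w j r)              ≡⟨ cong (κ B j *_) (∑gen-chain cw j r≤L) ⟩
    κ B j * count κ j r                   ∎

perimeter-∷ : ∀ j τ → perimeter (j ∷ τ) ≡ j + length τ
perimeter-∷ j τ = cong (_∸ 1) (+-suc j (length τ))

perimeter-∷⇔ : ∀ {j n} τ → j ≤ n → (perimeter (j ∷ τ) ≡ n) ⇔ (length τ ≡ n ∸ j)
perimeter-∷⇔ {j} {n} τ j≤n = mk⇔
  (λ e → trans (sym (m+n∸m≡n j (length τ))) (cong (_∸ j) (trans (sym (perimeter-∷ j τ)) e)))
  (λ e → trans (perimeter-∷ j τ) (trans (cong (_+_ j) e) (m+[n∸m]≡n j≤n)))

∑candidates : ∀ {p} {P : Pred (List ℕ) p} (P? : Decidable P) (w : List ℕ → ℕ) n →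
              (∀ {π} → P π → perimeter π ≡ suc n) →
              sum (map w (filter P? (candidates (suc n))))
                ≡ ∑₁ (suc n) (λ j → ∑gen n j (λ τ → ⟦ P? (j ∷ τ) ⟧ * w (j ∷ τ)))
∑candidates P? w n perimeter≡ = begin
  sum (map w (filter P? (candidates (suc n))))
    ≡⟨ sum-map-filter P? w (candidates (suc n)) ⟩
  ∑gen (suc n) (suc n) (λ π → ⟦ P? π ⟧ * w π)
    ≡⟨ ∑gen-suc n (suc n) (λ π → ⟦ P? π ⟧ * w π) ⟩
  ⟦ P? [] ⟧ * w [] + heads
    ≡⟨ cong (λ x → x * w [] + heads) (⟦⟧-false (P? []) λ P[] → 0≢1+n (perimeter≡ {[]} P[])) ⟩
  heads
    ∎
  where
  heads : ℕ
  heads = ∑₁ (suc n) (λ j → ∑gen n j (λ τ → ⟦ P? (j ∷ τ) ⟧ * w (j ∷ τ)))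

%-window : ∀ {N i j} .{{_ : NonZero N}} → 1 ≤ i → i ≤ N → 1 ≤ j → j < i + N →
           j % N ≡ i % N → j ≡ i
%-window {N} {i} {j} 1≤i i≤N 1≤j j<i+N eq with j <? N | m≤n⇒m<n∨m≡n i≤N
... | yes j<N | inj₁ i<N  = trans (sym (m<n⇒m%n≡m j<N)) (trans eq (m<n⇒m%n≡m i<N))
... | yes j<N | inj₂ refl =
  contradiction (sym (trans (sym (m<n⇒m%n≡m j<N)) (trans eq (n%n≡0 N)))) (<⇒≢ 1≤j)
... | no  j≮N | i<N∨i≡N   = wrap i<N∨i≡N
  where
  j′ : ℕ
  j′ = j ∸ N
  j≡j′+N : j ≡ j′ + N
  j≡j′+N = sym (m∸n+n≡m (≮⇒≥ j≮N))
  j′<i : j′ < i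
  j′<i = +-cancelʳ-< N j′ i (subst (_< i + N) j≡j′+N j<i+N)
  j%N≡j′ : j % N ≡ j′
  j%N≡j′ = trans (cong (_% N) j≡j′+N) (trans ([m+n]%n≡m%n j′ N) (m<n⇒m%n≡m (<-≤-trans j′<i i≤N)))
  wrap : i < N ⊎ i ≡ N → j ≡ i
  wrap (inj₁ i<N)  = contradiction (trans (sym j%N≡j′) (trans eq (m<n⇒m%n≡m i<N))) (<⇒≢ j′<i)
  wrap (inj₂ refl) = trans j≡j′+N (cong (_+ N) (trans (sym j%N≡j′) (trans eq (n%n≡0 N))))

suc-∸-≤ : ∀ {n j} → 1 ≤ j → suc n ∸ j ≤ n
suc-∸-≤ {n} {suc j} _ = m∸n≤m n j

module Congruent (d c : ℕ) (1≤c : 1 ≤ c) (c≤N : c ≤ suc d) where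

  N : ℕ
  N = suc d

  open Series N

  inClass : ℕ → ℕ
  inClass j = ⟦ j % N ≟ c % N ⟧

  inClass-c : inClass c ≡ 1
  inClass-c = ⟦⟧-true (c % N ≟ c % N) refl

  inClass-shift : ∀ k j → inClass (k * N + j) ≡ inClass j
  inClass-shift k j =
    cong (λ r → ⟦ r ≟ c % N ⟧) (trans (cong (_% N) (+-comm (k * N) j)) ([m+kn]%n≡m%n j k N))

  inClass-near : ∀ j → 1 ≤ j → j ≤ c + d → j ≢ c → inClass j ≡ 0
  inClass-near j 1≤j j≤c+d j≢c =
    ⟦⟧-false (j % N ≟ c % N) (j≢c ∘ %-window 1≤c c≤N 1≤j (subst (j <_) (sym (+-suc c d)) (s≤s j≤c+d)))

  ∑-residue : ∀ k (h : ℕ → ℕ) → ∑₁ (k * N + c) (λ j → inClass j * h j) ≡ ∑< (suc k) (λ i → h (i * N + c))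
  ∑-residue zero    h = trans
    (∑₁-single (λ j → inClass j * h j) 1≤c ≤-refl λ j 1≤j j≤c j≢c →
       cong (_* h j) (inClass-near j 1≤j (≤-trans j≤c (m≤m+n c d)) j≢c))
    (cong (_* h c) inClass-c)
  ∑-residue (suc k) h = begin
    ∑₁ (N + k * N + c) φ
      ≡⟨ cong (λ m → ∑₁ m φ) (+-CS.xy∙z≈yz∙x N (k * N) c) ⟩
    ∑₁ (k * N + c + N) φ
      ≡⟨ ∑₁-split (k * N + c) N φ ⟩
    ∑₁ (k * N + c) φ + ∑₁ N (λ t → φ (k * N + c + t))
      ≡⟨ cong₂ _+_ (∑-residue k h) block ⟩
    ∑< (suc k) (λ i → h (i * N + c)) + h (suc k * N + c)
      ≡⟨ ∑<-last (suc k) (λ i → h (i * N + c)) ⟨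
    ∑< (suc (suc k)) (λ i → h (i * N + c))
      ∎
    where
    φ : ℕ → ℕ
    φ j = inClass j * h j
    others : ∀ t → 1 ≤ t → t ≤ N → t ≢ N → φ (k * N + c + t) ≡ 0
    others t 1≤t t≤N t≢N = cong (_* h (k * N + c + t)) (begin
      inClass (k * N + c + t)
        ≡⟨ cong inClass (+-assoc (k * N) c t) ⟩
      inClass (k * N + (c + t))
        ≡⟨ inClass-shift k (c + t) ⟩
      inClass (c + t)
        ≡⟨ inClass-near (c + t) (≤-trans 1≤c (m≤m+n c t)) (+-monoʳ-≤ c (≤-pred (≤∧≢⇒< t≤N t≢N)))
            (<⇒≢ (m<m+n c 1≤t) ∘ sym) ⟩
      0
        ∎)
    block : ∑₁ N (λ t → φ (k * N + c + t)) ≡ h (suc k * N + c)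
    block = begin
      ∑₁ N (λ t → φ (k * N + c + t))
        ≡⟨ ∑₁-single (λ t → φ (k * N + c + t)) (s≤s z≤n) ≤-refl others ⟩
      φ (k * N + c + N)
        ≡⟨ cong φ (+-CS.xy∙z≈yz∙x N (k * N) c) ⟨
      φ (suc k * N + c)
        ≡⟨ cong (_* h (suc k * N + c)) (trans (inClass-shift (suc k) c) inClass-c) ⟩
      1 * h (suc k * N + c)
        ≡⟨ *-identityˡ _ ⟩
      h (suc k * N + c)
        ∎

  tailCount : ℕ → ℕ → ℕ
  tailCount = count (λ _ → inClass)

  tailCount-binom : ∀ k r → tailCount (k * N + c) r ≡ binom k r
  tailCount-binom k zero    = sym (binom-zeroʳ k)
  tailCount-binom k (suc r) = begin
    ∑₁ (k * N + c) (λ j → inClass j * tailCount j r)  ≡⟨ ∑-residue k (λ j → tailCount j r) ⟩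
    ∑< (suc k) (λ i → tailCount (i * N + c) r)        ≡⟨ ∑<-cong (suc k) (λ i _ → tailCount-binom i r) ⟩
    ∑< (suc k) (λ i → binom i r)                      ≡⟨ binom-hockey k r ⟨
    binom k (suc r)                                   ∎

  ∑heads-Λ : ∀ (ξ : ℕ → ℕ → ℕ) n →
             ∑₁ n (λ j → inClass j * ξ j (n ∸ j)) ≡ delay c (Λ (λ k → ξ (k * N + c))) n
  ∑heads-Λ ξ n = begin
    ∑₁ n (λ j → inClass j * ξ j (n ∸ j))
      ≡⟨ ∑₁-cong n (λ j _ j≤n → cong (inClass j *_) (delay-∸ (ξ j) j≤n)) ⟨
    ∑₁ n φ
      ≡⟨ ∑₁-extend φ (≤-trans (m≤m*n n N) (m≤m+n (n * N) c)) vanish ⟨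
    ∑₁ (n * N + c) φ
      ≡⟨ ∑-residue n (λ j → delay j (ξ j) n) ⟩
    ∑< (suc n) (λ i → delay (i * N + c) (ξ (i * N + c)) n)
      ≡⟨ ∑<-cong (suc n) (λ i _ → delay-+ (i * N) c (ξ (i * N + c)) n) ⟩
    Λ (λ k → delay c (ξ (k * N + c))) n
      ≡⟨ Λ-delay c (λ k → ξ (k * N + c)) n ⟩
    delay c (Λ (λ k → ξ (k * N + c))) n
      ∎
    where
    φ : ℕ → ℕ
    φ j = inClass j * delay j (ξ j) n
    vanish : ∀ j → n < j → φ j ≡ 0
    vanish j n<j = trans (cong (inClass j *_) (delay-below (ξ j) n<j)) (*-zeroʳ (inClass j))

  tail? : ∀ r τ → Dec (length τ ≡ r × CongParts d c τ)
  tail? r τ = (length τ ≟ r) ×-dec congParts? d c τ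

  tailWeight : ℕ → ℕ → List ℕ → ℕ
  tailWeight _ r τ = ⟦ tail? r τ ⟧

  tailWeight-chain : ChainWeight (λ _ → inClass) tailWeight
  tailWeight-chain = record
    { nil-zero  = λ _ → ⟦⟧-true (tail? 0 []) (refl , [])
    ; cons-zero = λ _ x τ → ⟦⟧-false (tail? 0 (x ∷ τ)) λ { (() , _) }
    ; nil-suc   = λ _ r → ⟦⟧-false (tail? (suc r) []) λ { (() , _) }
    ; cons-suc  = λ _ r x τ → trans
        (⟦⟧-⇔ unfold (tail? (suc r) (x ∷ τ)) ((x % N ≟ c % N) ×-dec tail? r τ))
        (⟦⟧-× (x % N ≟ c % N) (tail? r τ))
    }
    where
    unfold : ∀ {r x τ} → (suc (length τ) ≡ suc r × CongParts d c (x ∷ τ))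
                       ⇔ (x % N ≡ c % N × (length τ ≡ r × CongParts d c τ))
    unfold = mk⇔ (λ { (e , px ∷ pτ) → px , suc-injective e , pτ })
                 (λ { (px , e , pτ) → cong suc e , px ∷ pτ })

  PF? : ∀ n π → Dec (IsPartition π × (perimeter π ≡ n × CongParts d c π))
  PF? n π = isPartition? π ×-dec (perimeter π ≟ n ×-dec congParts? d c π)

  head-split : ∀ {n j τ} → 1 ≤ j → j ≤ n → BoundedPartition j τ →
               ⟦ PF? n (j ∷ τ) ⟧ ≡ inClass j * tailWeight j (n ∸ j) τ
  head-split {n} {j} {τ} 1≤j j≤n bτ =
    trans (⟦⟧-⇔ split (PF? n (j ∷ τ)) ((j % N ≟ c % N) ×-dec tail? (n ∸ j) τ))
          (⟦⟧-× (j % N ≟ c % N) (tail? (n ∸ j) τ))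
    where
    open Equivalence (perimeter-∷⇔ τ j≤n)
    split : (IsPartition (j ∷ τ) × (perimeter (j ∷ τ) ≡ n × CongParts d c (j ∷ τ)))
          ⇔ (j % N ≡ c % N × (length τ ≡ n ∸ j × CongParts d c τ))
    split = mk⇔ (λ { (_ , e , pj ∷ pτ) → pj , to e , pτ })
                (λ { (pj , e , pτ) → cons-partition 1≤j bτ , from e , pj ∷ pτ })

  ∑𝓕-by-length : ∀ (ω : ℕ → ℕ) n →
    sum (map (ω ∘ length) (𝓕 d c (suc n))) ≡ delay c (Λ (λ k r → ω (suc r) * binom k r)) (suc n)
  ∑𝓕-by-length ω n = begin
    sum (map (ω ∘ length) (𝓕 d c (suc n)))
      ≡⟨ ∑candidates (PF? (suc n)) (ω ∘ length) n (λ { (_ , e , _) → e }) ⟩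
    ∑₁ (suc n) (λ j → ∑gen n j (λ τ → ⟦ PF? (suc n) (j ∷ τ) ⟧ * ω (suc (length τ))))
      ≡⟨ ∑₁-cong (suc n) per-head ⟩
    ∑₁ (suc n) (λ j → inClass j * (ω (suc (suc n ∸ j)) * tailCount j (suc n ∸ j)))
      ≡⟨ ∑heads-Λ (λ j r → ω (suc r) * tailCount j r) (suc n) ⟩
    delay c (Λ (λ k r → ω (suc r) * tailCount (k * N + c) r)) (suc n)
      ≡⟨ delay-cong c (λ i _ → Λ-cong (λ k r → cong (ω (suc r) *_) (tailCount-binom k r)) i) ⟩
    delay c (Λ (λ k r → ω (suc r) * binom k r)) (suc n)
      ∎
    where
    per-head : ∀ j → 1 ≤ j → j ≤ suc n →
               ∑gen n j (λ τ → ⟦ PF? (suc n) (j ∷ τ) ⟧ * ω (suc (length τ)))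
                 ≡ inClass j * (ω (suc (suc n ∸ j)) * tailCount j (suc n ∸ j))
    per-head j 1≤j j≤n = begin
      ∑gen n j (λ τ → ⟦ PF? (suc n) (j ∷ τ) ⟧ * ω (suc (length τ)))
        ≡⟨ ∑gen-cong n j weight ⟩
      ∑gen n j (λ τ → inClass j * (W * tailWeight j r τ))
        ≡⟨ ∑gen-*ˡ n j (inClass j) (λ τ → W * tailWeight j r τ) ⟩
      inClass j * ∑gen n j (λ τ → W * tailWeight j r τ)
        ≡⟨ cong (inClass j *_) (∑gen-*ˡ n j W (tailWeight j r)) ⟩
      inClass j * (W * ∑gen n j (tailWeight j r))
        ≡⟨ cong (λ x → inClass j * (W * x)) (∑gen-chain tailWeight-chain j (suc-∸-≤ 1≤j)) ⟩
      inClass j * (W * tailCount j r)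
        ∎
      where
      r W : ℕ
      r = suc n ∸ j
      W = ω (suc r)
      weight : ∀ τ → BoundedPartition j τ →
               ⟦ PF? (suc n) (j ∷ τ) ⟧ * ω (suc (length τ)) ≡ inClass j * (W * tailWeight j r τ)
      weight τ bτ = begin
        ⟦ PF? (suc n) (j ∷ τ) ⟧ * ω (suc (length τ))
          ≡⟨ ⟦⟧-*-cong (PF? (suc n) (j ∷ τ))
               (λ { (_ , e , _) → cong (ω ∘ suc) (Equivalence.to (perimeter-∷⇔ τ j≤n) e) }) ⟩
        ⟦ PF? (suc n) (j ∷ τ) ⟧ * W
          ≡⟨ cong (_* W) (head-split 1≤j j≤n bτ) ⟩
        inClass j * tailWeight j r τ * W
          ≡⟨ *-CS.xy∙z≈x∙zy (inClass j) (tailWeight j r τ) W ⟩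
        inClass j * (W * tailWeight j r τ)
          ∎

  f-delay : ∀ n → 1 ≤ n → f d c n ≡ delay c g n
  f-delay (suc n) _ = begin
    f d c (suc n)
      ≡⟨ length≡sum-map-1 (𝓕 d c (suc n)) ⟩
    sum (map (λ _ → 1) (𝓕 d c (suc n)))
      ≡⟨ ∑𝓕-by-length (λ _ → 1) n ⟩
    delay c (Λ (λ k r → 1 * binom k r)) (suc n)
      ≡⟨ delay-cong c (λ i _ → Λ-cong (λ k r → *-identityˡ (binom k r)) i) ⟩
    delay c g (suc n)
      ∎

  sumλ𝓕 : ∀ n → 1 ≤ n → sumλ (𝓕 d c n) ≡ delay c (Λ weightF) n
  sumλ𝓕 (suc n) _ = ∑𝓕-by-length id n

module Distinct (d a : ℕ) (1≤a : 1 ≤ a) where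

  N : ℕ
  N = suc d

  open Series N

  gap : ℕ → ℕ → ℕ
  gap B x = ⟦ a ≤? x ⟧ * ⟦ x + d ≤? B ⟧

  tailCount : ℕ → ℕ → ℕ
  tailCount = count gap

  -- The number of d-distinct partitions with parts ≥ a, r + 1 parts and largest part j.
  withLargest : ℕ → ℕ → ℕ
  withLargest r j = ⟦ a ≤? j ⟧ * tailCount j r

  withLargest-delay : ∀ r → withLargest r ≗ delay (r * d + a) (flip binom r)
  withLargest-delay zero    j = by-cases (≤-<-connex a j)
    where
    by-cases : a ≤ j ⊎ j < a → withLargest 0 j ≡ delay a (flip binom 0) j
    by-cases (inj₁ a≤j) = begin
      ⟦ a ≤? j ⟧ * 1            ≡⟨ cong (_* 1) (⟦⟧-true (a ≤? j) a≤j) ⟩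
      1                        ≡⟨ binom-zeroʳ (j ∸ a) ⟨
      binom (j ∸ a) 0          ≡⟨ delay-∸ (flip binom 0) a≤j ⟨
      delay a (flip binom 0) j ∎
    by-cases (inj₂ j<a) = trans (cong (_* 1) (⟦⟧-false (a ≤? j) (<⇒≱ j<a))) (sym (delay-below _ j<a))
  withLargest-delay (suc r) j = begin
    ⟦ a ≤? j ⟧ * ∑₁ j (λ x → gap j x * tailCount x r)
      ≡⟨ cong (⟦ a ≤? j ⟧ *_) (∑₁-cong j λ x _ _ →
           *-CS.xy∙z≈y∙xz ⟦ a ≤? x ⟧ ⟦ x + d ≤? j ⟧ (tailCount x r)) ⟩
    ⟦ a ≤? j ⟧ * ∑₁ j (λ x → ⟦ x + d ≤? j ⟧ * withLargest r x)
      ≡⟨ cong (⟦ a ≤? j ⟧ *_) (∑₁-window d j (withLargest r)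
           (cong (_* tailCount 0 r) (⟦⟧-false (a ≤? 0) (<⇒≱ 1≤a)))) ⟩
    ⟦ a ≤? j ⟧ * delay d (λ u → ∑< (suc u) (withLargest r)) j
      ≡⟨ cong (⟦ a ≤? j ⟧ *_) (delay-cong d λ u _ → partial-sums u) ⟩
    ⟦ a ≤? j ⟧ * delay d (delay (r * d + a) (flip binom (suc r))) j
      ≡⟨ cong (⟦ a ≤? j ⟧ *_) (trans (cong (λ m → delay m (flip binom (suc r)) j) (+-assoc d (r * d) a))
                                     (delay-+ d (r * d + a) (flip binom (suc r)) j)) ⟨
    ⟦ a ≤? j ⟧ * delay (suc r * d + a) (flip binom (suc r)) j
      ≡⟨ ⟦≤⟧-delay j _ (m≤n+m a (suc r * d)) ⟩
    delay (suc r * d + a) (flip binom (suc r)) j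
      ∎
    where
    partial-sums : ∀ u → ∑< (suc u) (withLargest r) ≡ delay (r * d + a) (flip binom (suc r)) u
    partial-sums u = begin
      ∑< (suc u) (withLargest r)                                ≡⟨ ∑<-cong (suc u) (λ i _ → withLargest-delay r i) ⟩
      ∑< (suc u) (delay (r * d + a) (flip binom r))             ≡⟨ ∑≤-delay (r * d + a) (flip binom r) u ⟩
      delay (r * d + a) (λ v → ∑< (suc v) (flip binom r)) u     ≡⟨ delay-cong (r * d + a) (λ v _ → binom-hockey v r) ⟨
      delay (r * d + a) (flip binom (suc r)) u                  ∎

  Tail : ℕ → ℕ → List ℕ → Set
  Tail B r τ = length τ ≡ r × (DDistinct d τ × (PartsAtLeast a τ × All (λ y → y + d ≤ B) τ))

  tail? : ∀ B r τ → Dec (Tail B r τ)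
  tail? B r τ =
    (length τ ≟ r) ×-dec (dDistinct? d τ ×-dec (partsAtLeast? a τ ×-dec All.all? (λ y → y + d ≤? B) τ))

  tailWeight : ℕ → ℕ → List ℕ → ℕ
  tailWeight B r τ = ⟦ tail? B r τ ⟧

  tailWeight-chain : ChainWeight gap tailWeight
  tailWeight-chain = record
    { nil-zero  = λ B → ⟦⟧-true (tail? B 0 []) (refl , [] , [] , [])
    ; cons-zero = λ B x τ → ⟦⟧-false (tail? B 0 (x ∷ τ)) λ { (() , _) }
    ; nil-suc   = λ B r → ⟦⟧-false (tail? B (suc r) []) λ { (() , _) }
    ; cons-suc  = λ B r x τ → begin
        ⟦ tail? B (suc r) (x ∷ τ) ⟧
          ≡⟨ ⟦⟧-⇔ unfold (tail? B (suc r) (x ∷ τ)) ((a ≤? x) ×-dec ((x + d ≤? B) ×-dec tail? x r τ)) ⟩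
        ⟦ (a ≤? x) ×-dec ((x + d ≤? B) ×-dec tail? x r τ) ⟧
          ≡⟨ ⟦⟧-× (a ≤? x) ((x + d ≤? B) ×-dec tail? x r τ) ⟩
        ⟦ a ≤? x ⟧ * ⟦ (x + d ≤? B) ×-dec tail? x r τ ⟧
          ≡⟨ cong (⟦ a ≤? x ⟧ *_) (⟦⟧-× (x + d ≤? B) (tail? x r τ)) ⟩
        ⟦ a ≤? x ⟧ * (⟦ x + d ≤? B ⟧ * tailWeight x r τ)
          ≡⟨ *-assoc ⟦ a ≤? x ⟧ _ _ ⟨
        gap B x * tailWeight x r τ
          ∎
    }
    where
    unfold : ∀ {B r x τ} → Tail B (suc r) (x ∷ τ) ⇔ (a ≤ x × (x + d ≤ B × Tail x r τ))
    unfold {x = x} = mk⇔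
      (λ { (e , (gaps ∷ dd) , (ax ∷ aτ) , (xB ∷ _)) → ax , xB , suc-injective e , dd , aτ , gaps })
      (λ { (ax , xB , e , dd , aτ , gaps) →
             cong suc e , (gaps ∷ dd) , (ax ∷ aτ) ,
             (xB ∷ All.map (λ y+d≤x → ≤-trans y+d≤x (≤-trans (m≤m+n x d) xB)) gaps) })

  PH? : ∀ n π → Dec (IsPartition π × (perimeter π ≡ n × (DDistinct d π × PartsAtLeast a π)))
  PH? n π = isPartition? π ×-dec (perimeter π ≟ n ×-dec (dDistinct? d π ×-dec partsAtLeast? a π))

  head-split : ∀ {n j τ} → 1 ≤ j → j ≤ n → BoundedPartition j τ →
               ⟦ PH? n (j ∷ τ) ⟧ ≡ ⟦ a ≤? j ⟧ * tailWeight j (n ∸ j) τ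
  head-split {n} {j} {τ} 1≤j j≤n bτ =
    trans (⟦⟧-⇔ split (PH? n (j ∷ τ)) ((a ≤? j) ×-dec tail? j (n ∸ j) τ))
          (⟦⟧-× (a ≤? j) (tail? j (n ∸ j) τ))
    where
    open Equivalence (perimeter-∷⇔ τ j≤n)
    split : (IsPartition (j ∷ τ) ×
             (perimeter (j ∷ τ) ≡ n × (DDistinct d (j ∷ τ) × PartsAtLeast a (j ∷ τ))))
          ⇔ (a ≤ j × Tail j (n ∸ j) τ)
    split = mk⇔ (λ { (_ , e , (gaps ∷ dd) , (aj ∷ aτ)) → aj , to e , dd , aτ , gaps })
                (λ { (aj , e , dd , aτ , gaps) →
                       cons-partition 1≤j bτ , from e , (gaps ∷ dd) , (aj ∷ aτ) })

  sumλ𝓗 : ∀ n → 1 ≤ n → sumλ (𝓗 d a n) ≡ delay a (Λ weightH) n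
  sumλ𝓗 (suc n) _ = begin
    sumλ (𝓗 d a (suc n))
      ≡⟨ ∑candidates (PH? (suc n)) length n (λ { (_ , e , _) → e }) ⟩
    ∑₁ (suc n) (λ j → ∑gen n j (λ τ → ⟦ PH? (suc n) (j ∷ τ) ⟧ * suc (length τ)))
      ≡⟨ ∑₁-cong (suc n) per-head ⟩
    ∑₁ (suc n) (λ j → suc (suc n ∸ j) * withLargest (suc n ∸ j) j)
      ≡⟨ ∑₁-antidiagonal (suc n) (λ j r → suc r * withLargest r j) ⟩
    ∑< (suc n) (λ r → suc r * withLargest r (suc n ∸ r))
      ≡⟨ ∑<-cong (suc n) column ⟩
    Λₘ (suc n) (λ r → delay a (λ i → suc r * binom i r)) (suc n)
      ≡⟨ Λₘ-delay (suc n) a (λ r i → suc r * binom i r) (suc n) ⟩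
    delay a (Λₘ (suc n) (λ r i → suc r * binom i r)) (suc n)
      ≡⟨ delay-cong a (λ i e → trans (Λₘ-trunc (λ r i → suc r * binom i r) (m+n≡o⇒m<o 1≤a e))
                                      (Λ-cong (λ k r → cong (suc k *_) (binom-sym r k)) i)) ⟩
    delay a (Λ weightH) (suc n)
      ∎
    where
    per-head : ∀ j → 1 ≤ j → j ≤ suc n →
               ∑gen n j (λ τ → ⟦ PH? (suc n) (j ∷ τ) ⟧ * suc (length τ))
                 ≡ suc (suc n ∸ j) * withLargest (suc n ∸ j) j
    per-head j 1≤j j≤n = begin
      ∑gen n j (λ τ → ⟦ PH? (suc n) (j ∷ τ) ⟧ * suc (length τ))
        ≡⟨ ∑gen-cong n j weight ⟩
      ∑gen n j (λ τ → ⟦ a ≤? j ⟧ * (suc r * tailWeight j r τ))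
        ≡⟨ ∑gen-*ˡ n j ⟦ a ≤? j ⟧ (λ τ → suc r * tailWeight j r τ) ⟩
      ⟦ a ≤? j ⟧ * ∑gen n j (λ τ → suc r * tailWeight j r τ)
        ≡⟨ cong (⟦ a ≤? j ⟧ *_) (∑gen-*ˡ n j (suc r) (tailWeight j r)) ⟩
      ⟦ a ≤? j ⟧ * (suc r * ∑gen n j (tailWeight j r))
        ≡⟨ cong (λ x → ⟦ a ≤? j ⟧ * (suc r * x)) (∑gen-chain tailWeight-chain j (suc-∸-≤ 1≤j)) ⟩
      ⟦ a ≤? j ⟧ * (suc r * tailCount j r)
        ≡⟨ *-CS.x∙yz≈y∙xz ⟦ a ≤? j ⟧ (suc r) (tailCount j r) ⟩
      suc r * withLargest r j
        ∎
      where
      r : ℕ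
      r = suc n ∸ j
      weight : ∀ τ → BoundedPartition j τ →
               ⟦ PH? (suc n) (j ∷ τ) ⟧ * suc (length τ) ≡ ⟦ a ≤? j ⟧ * (suc r * tailWeight j r τ)
      weight τ bτ = begin
        ⟦ PH? (suc n) (j ∷ τ) ⟧ * suc (length τ)
          ≡⟨ ⟦⟧-*-cong (PH? (suc n) (j ∷ τ))
               (λ { (_ , e , _) → cong suc (Equivalence.to (perimeter-∷⇔ τ j≤n) e) }) ⟩
        ⟦ PH? (suc n) (j ∷ τ) ⟧ * suc r
          ≡⟨ cong (_* suc r) (head-split 1≤j j≤n bτ) ⟩
        ⟦ a ≤? j ⟧ * tailWeight j r τ * suc r
          ≡⟨ *-CS.xy∙z≈x∙zy ⟦ a ≤? j ⟧ (tailWeight j r τ) (suc r) ⟩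
        ⟦ a ≤? j ⟧ * (suc r * tailWeight j r τ)
          ∎
    column : ∀ r → r < suc n →
             suc r * withLargest r (suc n ∸ r) ≡ delay (r * N) (delay a (λ i → suc r * binom i r)) (suc n)
    column r r<n = begin
      suc r * withLargest r (suc n ∸ r)
        ≡⟨ cong (suc r *_) (withLargest-delay r (suc n ∸ r)) ⟩
      suc r * delay (r * d + a) (flip binom r) (suc n ∸ r)
        ≡⟨ delay-*ˡ (r * d + a) (suc r) (flip binom r) (suc n ∸ r) ⟨
      delay (r * d + a) (λ i → suc r * binom i r) (suc n ∸ r)
        ≡⟨ delay-∸ _ (<⇒≤ r<n) ⟨
      delay r (delay (r * d + a) (λ i → suc r * binom i r)) (suc n)
        ≡⟨ delay-+ r (r * d + a) _ (suc n) ⟨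
      delay (r + (r * d + a)) (λ i → suc r * binom i r) (suc n)
        ≡⟨ cong (λ m → delay m (λ i → suc r * binom i r) (suc n)) (regroup r d a) ⟩
      delay (r * N + a) (λ i → suc r * binom i r) (suc n)
        ≡⟨ delay-+ (r * N) a _ (suc n) ⟩
      delay (r * N) (delay a (λ i → suc r * binom i r)) (suc n)
        ∎
      where
      regroup : ∀ r d a → r + (r * d + a) ≡ r * suc d + a
      regroup = solve-∀

Σ1to-f*f : ∀ d n {a c} → 1 ≤ a → a ≤ suc d → 1 ≤ c → c ≤ suc d →
           Σ1to (n ∸ 1) (λ m → f d a (n ∸ m) * f d c m) ≡ delay a (delay c (Series.conv (suc d))) n
Σ1to-f*f d zero    {a} {c} 1≤a _   1≤c _   = sym (delay-below _ 1≤a)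
Σ1to-f*f d (suc n) {a} {c} 1≤a a≤N 1≤c c≤N = begin
  Σ1to n (λ m → f d a (suc n ∸ m) * f d c m)
    ≡⟨ sum-range1 n _ ⟩
  ∑₁ n (λ m → f d a (suc n ∸ m) * f d c m)
    ≡⟨ ∑₁-cong n (λ m 1≤m m≤n → cong₂ _*_
        (Congruent.f-delay d a 1≤a a≤N (suc n ∸ m) (m<n⇒0<n∸m (s≤s m≤n)))
        (Congruent.f-delay d c 1≤c c≤N m 1≤m)) ⟩
  ∑₁ n (λ m → delay a g (suc n ∸ m) * delay c g m)
    ≡⟨ sum-range1 n _ ⟨
  Σ1to n (λ m → delay a g (suc n ∸ m) * delay c g m)
    ≡⟨ Σ1to-⊛ (suc n) (delay c g) (delay a g) (delay-below g 1≤c) (delay-below g 1≤a) ⟩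
  (delay c g ⊛ delay a g) (suc n)
    ≡⟨ delay-⊛ c g (delay a g) (suc n) ⟩
  delay c (g ⊛ delay a g) (suc n)
    ≡⟨ delay-cong c (λ i _ → ⊛-delay a g g i) ⟩
  delay c (delay a conv) (suc n)
    ≡⟨ delay-comm c a conv (suc n) ⟩
  delay a (delay c conv) (suc n)
    ∎
  where open Series (suc d)

+[m+n]-+[m+o]≡+n-+o : ∀ x y z → + (x + y) - + (x + z) ≡ + y - + z
+[m+n]-+[m+o]≡+n-+o x y z = begin
  + (x + y) - + (x + z)  ≡⟨ ℤP.m-n≡m⊖n (x + y) (x + z) ⟩
  (x + y) ⊖ (x + z)      ≡⟨ ℤP.+-cancelˡ-⊖ x y z ⟩
  y ⊖ z                  ≡⟨ ℤP.m-n≡m⊖n y z ⟨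
  + y - + z              ∎

theorem1p3 : (d n a : ℕ) → 1 ≤ d → 1 ≤ n → 1 ≤ a → a ≤ suc d →
    (+ sumλ (𝓕 d a n)) - (+ sumλ (𝓗 d a n))
      ≡ (+ Σ1to (n ∸ 1) (λ m → f d a (n ∸ m) * f d 1 m))
        - (+ Σ1to (n ∸ 1) (λ m → f d a (n ∸ m) * f d (suc d) m))
theorem1p3 d n a _ 1≤n 1≤a a≤N = begin
  + sumλ (𝓕 d a n) - + sumλ (𝓗 d a n)
    ≡⟨ cong₂ diff (Congruent.sumλ𝓕 d a 1≤a a≤N n 1≤n) (Distinct.sumλ𝓗 d a 1≤a n 1≤n) ⟩
  diff (delay a (Λ weightF) n) (delay a (Λ weightH) n)
    ≡⟨ cong₂ diff (delay-cong a λ i _ → ΛweightF≗ i) (delay-cong a λ i _ → ΛweightH≗ i) ⟩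
  diff (delay a (g ⊕ delay 1 conv) n) (delay a (g ⊕ delay N conv) n)
    ≡⟨ cong₂ diff (delay-⊕ a g (delay 1 conv) n) (delay-⊕ a g (delay N conv) n) ⟩
  diff (delay a g n + delay a (delay 1 conv) n) (delay a g n + delay a (delay N conv) n)
    ≡⟨ +[m+n]-+[m+o]≡+n-+o (delay a g n) _ _ ⟩
  diff (delay a (delay 1 conv) n) (delay a (delay N conv) n)
    ≡⟨ cong₂ diff (Σ1to-f*f d n 1≤a a≤N ≤-refl (s≤s z≤n)) (Σ1to-f*f d n 1≤a a≤N (s≤s z≤n) ≤-refl) ⟨
  + Σ1to (n ∸ 1) (λ m → f d a (n ∸ m) * f d 1 m) - + Σ1to (n ∸ 1) (λ m → f d a (n ∸ m) * f d (suc d) m)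
    ∎
  where
  N : ℕ
  N = suc d
  open Series N
  diff : ℕ → ℕ → ℤ
  diff x y = + x - + y
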